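{- In $\mathfrak{h}[[Y,Z]]$ the identity \[ \frac{1}{1+yY}\,\Phi_{ -yY}\!\left(\frac{1}{1-zZ}\right)=\frac{1}{1-zZ}\ \text{ш}\ \frac{1}{1+yY} \] holds.
   Context: Let $\mathfrak{h}=\mathbb{Q}\langle x,y\rangle$ be the noncommutative polynomial algebra over $\mathbb{Q}$ in $x,y$, and $z=x+y$. $Y,Z$ are commuting formal variables commuting with $x,y$; $\mathfrak{h}[[Y,Z]]$ is the ring of formal power series in $Y,Z$ with coefficients in $\mathfrak{h}$, and $\frac{1}{1-u}=\sum_{m\ge0}u^m$. The shuffle product $\text{ш}$ on $\mathfrak{h}$ is the $\mathbb{Q}$-bilinear map with $1\ \text{ш}\ w=w\ \text{ш}\ 1=w$ and $uw\ \text{ш}\ vw'=u(w\ \text{ш}\ vw')+v(uw\ \text{ш}\ w')$ for letters $u,v\in\{x,y\}$ and words $w,w'$; it is extended to power series bilinearly in the coefficients (with $Y,Z$ treated as scalars). $\Phi_{ -yY}$ is the continuous $\mathbb{Q}[[Y,Z]]$-algebra automorphism of $\mathfrak{h}[[Y,Z]]$ determined by $\Phi_{ -yY}(x)=x$ and $\Phi_{ -yY}(z)=z\frac{1}{1+yY}$. (On $\mathfrak{h}^1=\mathbb{Q}+\mathfrak{h}y$ it satisfies $\Phi_{ -yY}(w)=(1+yY)\bigl(\frac{1}{1+yY}\ast w\bigr)$, where $\ast$ is the harmonic product defined by $1\ast w=w\ast1=w$ and $z_kw\ast z_lw'=z_k(w\ast z_lw')+z_l(z_kw\ast w')+z_{k+l}(w\ast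 w')$ with $z_k=x^{k-1}y$.) -}

module Defs where

open import Data.Nat using (ℕ; zero; suc; _+_; _∸_)
open import Data.Rational using (ℚ; 0ℚ; 1ℚ; -_) renaming (_+_ to _+ℚ_; _*_ to _*ℚ_)
open import Data.List using (List; []; _∷_; _++_; map; concatMap; upTo; foldr)
open import Data.Product using (_×_; _,_)
open import Data.Bool using (Bool; true; false; if_then_else_)
open import Relation.Binary.PropositionalEquality using (_≡_)

data Letter : Set where
  x y : Letter

Word : Set
Word = List Letter

eqL : Letter → Letter → Bool
eqL x x = true
eqL y y = true
eqL _ _ = false

eqW : Word → Word → Bool
eqW [] [] = true
eqW (a ∷ v) (b ∷ w) = if eqL a b then eqW v w else false
eqW _ _ = false

-- 𝔥 = ℚ⟨x,y⟩ : finite formal ℚ-linear combinations of words.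
-- A polynomial is represented by a list of (coefficient, word) terms;
-- two representations are equal in 𝔥 iff all coefficients agree.

Poly : Set
Poly = List (ℚ × Word)

coeff : Poly → Word → ℚ
coeff [] w = 0ℚ
coeff ((c , v) ∷ p) w = (if eqW v w then c else 0ℚ) +ℚ coeff p w

_≈ₚ_ : Poly → Poly → Set
p ≈ₚ q = ∀ w → coeff p w ≡ coeff q w

pscale : ℚ → Poly → Poly
pscale c = map (λ { (d , w) → (c *ℚ d , w) })

pmul : Poly → Poly → Poly
pmul p q = concatMap (λ { (c , v) → map (λ { (d , w) → (c *ℚ d , v ++ w) }) q }) p

prefix : Letter → Poly → Poly
prefix u = map (λ { (c , w) → (c , u ∷ w) })

shw : Word → Word → Poly
shw [] w = (1ℚ , w) ∷ []
shw (u ∷ w) [] = (1ℚ , u ∷ w) ∷ []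
shw (u ∷ w) (v ∷ w') = prefix u (shw w (v ∷ w')) ++ prefix v (shw (u ∷ w) w')

psh : Poly → Poly → Poly
psh p q = concatMap (λ { (c , v) → concatMap (λ { (d , w) → pscale (c *ℚ d) (shw v w) }) q }) p

xP yP zP : Poly
xP = (1ℚ , x ∷ []) ∷ []
yP = (1ℚ , y ∷ []) ∷ []
zP = xP ++ yP

-- 𝔥[[Y,Z]] : S a b is the coefficient of Y^a Z^b.

Ser : Set
Ser = ℕ → ℕ → Poly

_≈ₛ_ : Ser → Ser → Set
S ≈ₛ T = ∀ a b → S a b ≈ₚ T a b

conv : (Poly → Poly → Poly) → Ser → Ser → Ser
conv op S T a b =
  concatMap (λ i → concatMap (λ j → op (S i j) (T (a ∸ i) (b ∸ j))) (upTo (suc b))) (upTo (suc a))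

smul : Ser → Ser → Ser
smul = conv pmul

ssh : Ser → Ser → Ser
ssh = conv psh

sadd : Ser → Ser → Ser
sadd S T a b = S a b ++ T a b

sscale : ℚ → Ser → Ser
sscale c S a b = pscale c (S a b)

sneg : Ser → Ser
sneg = sscale (- 1ℚ)

szero : Ser
szero a b = []

sconst : Poly → Ser
sconst p zero zero = p
sconst p _ _ = []

sone : Ser
sone = sconst ((1ℚ , []) ∷ [])

-- monomial p Y^i Z^j
smono : Poly → ℕ → ℕ → Ser
smono p zero zero zero zero = p
smono p zero (suc j) zero (suc b) = smono p zero j zero b
smono p (suc i) j (suc a) b = smono p i j a b
smono p _ _ _ _ = []

spow : Ser → ℕ → Ser
spow u zero = sone
spow u (suc m) = smul u (spow u m)

-- 1/(1-u) = Σ_{m≥0} u^m  (for u without constant term, only m ≤ a+b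
-- contribute to the coefficient of Y^a Z^b)
geom : Ser → Ser
geom u a b = concatMap (λ m → spow u m a b) (upTo (suc (a + b)))

yY zZ : Ser
yY = smono yP 1 0
zZ = smono zP 0 1

-- Φ_{-yY}: the continuous ℚ[[Y,Z]]-algebra endomorphism of 𝔥[[Y,Z]]
-- with x ↦ x and z ↦ z · 1/(1+yY), i.e. y = z - x ↦ z/(1+yY) - x.

phiL : Letter → Ser
phiL x = sconst xP
phiL y = sadd (smul (sconst zP) (geom (sneg yY))) (sneg (sconst xP))

phiW : Word → Ser
phiW w = foldr (λ u S → smul (phiL u) S) sone w

phiP : Poly → Ser
phiP p = foldr (λ { (c , w) S → sadd (sscale c (phiW w)) S }) szero p

Φ : Ser → Ser
Φ S a b =
  concatMap (λ i → concatMap (λ j → phiP (S i j) (a ∸ i) (b ∸ j)) (upTo (suc b))) (upTo (suc a))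

-- Write ε(F) for the constant term of a series F ∈ 𝔥[[Y,Z]] and ∂_c F for the series of
-- coefficients of the words beginning with the letter c, so that F is determined by ε(F), ∂_x F
-- and ∂_y F.  Both sides have constant term 1 and satisfy
--   ∂_x F = Z F,   ∂_y F = (Z − Y) F,
-- hence they agree.  For the shuffle side this is the Leibniz rule ∂_c (A ш B) = ∂_c A ш B + A ш ∂_c B
-- combined with ∂_c (1/(1 − zZ)) = Z/(1 − zZ), ∂_x (1/(1 + yY)) = 0 and ∂_y (1/(1 + yY)) = −Y/(1 + yY).
-- For the other side, Φ(1/(1 − zZ)) = Σ_m Φ(z)^m Z^m with Φ(z) = z (1 + yY)^(-1), and concatenation obeys
-- ∂_c (A B) = ε(A) ∂_c B + (∂_c A) B; so ∂_c Φ(z)^(m+1) = (1 + yY)^(-1) Φ(z)^m, and the product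
-- (1 + yY)^(-1) Φ(1/(1 − zZ)), whose first factor has constant term 1, satisfies the same system.

module Submission where

open import Defs
open import Data.Nat using (ℕ; zero; suc; _∸_; _≡ᵇ_) renaming (_+_ to _+ℕ_)
open import Data.Nat.Properties using (+-suc)
open import Data.Rational using (ℚ; 0ℚ; 1ℚ; -_; _+_; _*_; _-_)
open import Data.Rational.Properties
open import Data.Rational.Solver using (module +-*-Solver)
open import Algebra.Bundles using (CommutativeMonoid)
open import Algebra.Properties.Ring +-*-ring using (-1*x≈-x)
open import Algebra.Properties.CommutativeSemigroup (CommutativeMonoid.commutativeSemigroup +-0-commutativeMonoid)
  using (interchange)
open import Algebra.Properties.CommutativeSemigroup (CommutativeMonoid.commutativeSemigroup *-1-commutativeMonoid)
  using (x∙yz≈y∙xz)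
open import Data.List using ([]; _∷_; _++_; map; concatMap; upTo; applyUpTo)
open import Data.List.Properties using (++-identityʳ)
open import Data.Product using (_,_)
open import Data.Bool using (Bool; true; false; if_then_else_)
open import Relation.Binary.PropositionalEquality
open +-*-Solver using (solve; _:+_; _:*_; _:=_; con)

sum< : (ℕ → ℚ) → ℕ → ℚ
sum< g zero = 0ℚ
sum< g (suc n) = g 0 + sum< (λ m → g (suc m)) n

sum<-cong : ∀ {g h} n → (∀ m → g m ≡ h m) → sum< g n ≡ sum< h n
sum<-cong zero e = refl
sum<-cong (suc n) e = cong₂ _+_ (e 0) (sum<-cong n (λ m → e (suc m)))

sum<-zero : ∀ {g} n → (∀ m → g m ≡ 0ℚ) → sum< g n ≡ 0ℚ
sum<-zero zero e = refl
sum<-zero (suc n) e = trans (cong₂ _+_ (e 0) (sum<-zero n (λ m → e (suc m)))) (+-identityˡ 0ℚ)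

sum<-neg : ∀ g n → sum< (λ m → - g m) n ≡ - sum< g n
sum<-neg g zero = refl
sum<-neg g (suc n) = trans (cong (- g 0 +_) (sum<-neg (λ m → g (suc m)) n)) (sym (neg-distrib-+ (g 0) _))

antidiagonal : (ℕ → ℕ → ℚ) → ℕ → ℚ
antidiagonal f zero = f 0 0
antidiagonal f (suc a) = f 0 (suc a) + antidiagonal (λ i k → f (suc i) k) a

antidiagonal² : (ℕ → ℕ → ℕ → ℕ → ℚ) → ℕ → ℕ → ℚ
antidiagonal² f a b = antidiagonal (λ i k → antidiagonal (λ j l → f i j k l) b) a

sum<-antidiagonal : ∀ f a → sum< (λ i → f i (a ∸ i)) (suc a) ≡ antidiagonal f a
sum<-antidiagonal f zero = +-identityʳ _
sum<-antidiagonal f (suc a) = cong (f 0 (suc a) +_) (sum<-antidiagonal (λ i k → f (suc i) k) a)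

antidiagonal-cong : ∀ {f g} a → (∀ i k → f i k ≡ g i k) → antidiagonal f a ≡ antidiagonal g a
antidiagonal-cong zero e = e 0 0
antidiagonal-cong (suc a) e = cong₂ _+_ (e 0 (suc a)) (antidiagonal-cong a (λ i k → e (suc i) k))

antidiagonal-zero : ∀ {f} a → (∀ i k → f i k ≡ 0ℚ) → antidiagonal f a ≡ 0ℚ
antidiagonal-zero zero e = e 0 0
antidiagonal-zero (suc a) e =
  trans (cong₂ _+_ (e 0 (suc a)) (antidiagonal-zero a (λ i k → e (suc i) k))) (+-identityˡ 0ℚ)

antidiagonal-+ : ∀ f g a → antidiagonal (λ i k → f i k + g i k) a ≡ antidiagonal f a + antidiagonal g a
antidiagonal-+ f g zero = refl
antidiagonal-+ f g (suc a) =
  trans (cong (f 0 (suc a) + g 0 (suc a) +_) (antidiagonal-+ (λ i k → f (suc i) k) (λ i k → g (suc i) k) a))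
        (interchange (f 0 (suc a)) (g 0 (suc a)) _ _)

antidiagonal-scale : ∀ c f a → antidiagonal (λ i k → c * f i k) a ≡ c * antidiagonal f a
antidiagonal-scale c f zero = refl
antidiagonal-scale c f (suc a) =
  trans (cong (c * f 0 (suc a) +_) (antidiagonal-scale c (λ i k → f (suc i) k) a)) (sym (*-distribˡ-+ c _ _))

antidiagonal-first : ∀ {f} a → (∀ i k → f (suc i) k ≡ 0ℚ) → antidiagonal f a ≡ f 0 a
antidiagonal-first zero e = refl
antidiagonal-first {f} (suc a) e = trans (cong (f 0 (suc a) +_) (antidiagonal-zero a e)) (+-identityʳ _)

antidiagonal-last : ∀ {f} a → (∀ i k → f i (suc k) ≡ 0ℚ) → antidiagonal f a ≡ f a 0
antidiagonal-last zero e = refl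
antidiagonal-last {f} (suc a) e =
  trans (cong₂ _+_ (e 0 a) (antidiagonal-last {λ i k → f (suc i) k} a (λ i k → e (suc i) k))) (+-identityˡ _)

antidiagonal-shiftˡ : ∀ {f} a → (∀ k → f 0 k ≡ 0ℚ) → antidiagonal f (suc a) ≡ antidiagonal (λ i k → f (suc i) k) a
antidiagonal-shiftˡ {f} a e = trans (cong (_+ antidiagonal (λ i k → f (suc i) k) a) (e (suc a))) (+-identityˡ _)

antidiagonal-shiftʳ : ∀ {f} a → (∀ i → f i 0 ≡ 0ℚ) → antidiagonal f (suc a) ≡ antidiagonal (λ i k → f i (suc k)) a
antidiagonal-shiftʳ {f} zero e = trans (cong (f 0 1 +_) (e 1)) (+-identityʳ _)
antidiagonal-shiftʳ {f} (suc a) e =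
  cong (f 0 (suc (suc a)) +_) (antidiagonal-shiftʳ {λ i k → f (suc i) k} a (λ i → e (suc i)))

antidiagonal²-cong : ∀ {f g} a b → (∀ i j k l → f i j k l ≡ g i j k l) → antidiagonal² f a b ≡ antidiagonal² g a b
antidiagonal²-cong a b e = antidiagonal-cong a (λ i k → antidiagonal-cong b (λ j l → e i j k l))

antidiagonal²-zero : ∀ {f} a b → (∀ i j k l → f i j k l ≡ 0ℚ) → antidiagonal² f a b ≡ 0ℚ
antidiagonal²-zero a b e = antidiagonal-zero a (λ i k → antidiagonal-zero b (λ j l → e i j k l))

antidiagonal²-+ : ∀ f g a b →
  antidiagonal² (λ i j k l → f i j k l + g i j k l) a b ≡ antidiagonal² f a b + antidiagonal² g a b
antidiagonal²-+ f g a b =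
  trans (antidiagonal-cong a (λ i k → antidiagonal-+ (λ j l → f i j k l) (λ j l → g i j k l) b))
        (antidiagonal-+ (λ i k → antidiagonal (λ j l → f i j k l) b) (λ i k → antidiagonal (λ j l → g i j k l) b) a)

antidiagonal²-scale : ∀ c f a b → antidiagonal² (λ i j k l → c * f i j k l) a b ≡ c * antidiagonal² f a b
antidiagonal²-scale c f a b =
  trans (antidiagonal-cong a (λ i k → antidiagonal-scale c (λ j l → f i j k l) b))
        (antidiagonal-scale c (λ i k → antidiagonal (λ j l → f i j k l) b) a)

Coeffs : Set
Coeffs = Word → ℚ

∂ : Letter → Coeffs → Coeffs
∂ c f w = f (c ∷ w)

0ᶠ : Coeffs
0ᶠ _ = 0ℚ

_+ᶠ_ : Coeffs → Coeffs → Coeffs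
(f +ᶠ g) w = f w + g w

_*ᶠ_ : ℚ → Coeffs → Coeffs
(k *ᶠ f) w = k * f w

-ᶠ_ : Coeffs → Coeffs
(-ᶠ f) w = - f w

infixl 6 _+ᶠ_
infixl 7 _*ᶠ_ _·_ _ш_

_·_ : Coeffs → Coeffs → Coeffs
(f · g) [] = f [] * g []
(f · g) (c ∷ w) = f [] * g (c ∷ w) + (∂ c f · g) w

_ш_ : Coeffs → Coeffs → Coeffs
(f ш g) [] = f [] * g []
(f ш g) (c ∷ w) = (∂ c f ш g) w + (f ш ∂ c g) w

record IsBilinear (_∙_ : Coeffs → Coeffs → Coeffs) : Set where
  field
    ∙-cong : ∀ {f f′ g g′} → f ≗ f′ → g ≗ g′ → f ∙ g ≗ f′ ∙ g′
    ∙-distribʳ : ∀ f f′ g → (f +ᶠ f′) ∙ g ≗ f ∙ g +ᶠ f′ ∙ g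
    ∙-distribˡ : ∀ f g g′ → f ∙ (g +ᶠ g′) ≗ f ∙ g +ᶠ f ∙ g′
    ∙-scaleˡ : ∀ k f g → (k *ᶠ f) ∙ g ≗ k *ᶠ (f ∙ g)
    ∙-scaleʳ : ∀ k f g → f ∙ (k *ᶠ g) ≗ k *ᶠ (f ∙ g)

  ∙-zeroˡ : ∀ {f} g → f ≗ 0ᶠ → f ∙ g ≗ 0ᶠ
  ∙-zeroˡ {f} g f≗0 w = begin
    (f ∙ g) w            ≡⟨ ∙-cong (λ v → trans (f≗0 v) (sym (*-zeroˡ (f v)))) (λ _ → refl) w ⟩
    ((0ℚ *ᶠ f) ∙ g) w    ≡⟨ ∙-scaleˡ 0ℚ f g w ⟩
    0ℚ * (f ∙ g) w       ≡⟨ *-zeroˡ ((f ∙ g) w) ⟩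
    0ℚ                   ∎
    where open ≡-Reasoning

  ∙-zeroʳ : ∀ f {g} → g ≗ 0ᶠ → f ∙ g ≗ 0ᶠ
  ∙-zeroʳ f {g} g≗0 w = begin
    (f ∙ g) w            ≡⟨ ∙-cong (λ _ → refl) (λ v → trans (g≗0 v) (sym (*-zeroˡ (g v)))) w ⟩
    (f ∙ (0ℚ *ᶠ g)) w    ≡⟨ ∙-scaleʳ 0ℚ f g w ⟩
    0ℚ * (f ∙ g) w       ≡⟨ *-zeroˡ ((f ∙ g) w) ⟩
    0ℚ                   ∎
    where open ≡-Reasoning

  ∙-negˡ : ∀ f g → (-ᶠ f) ∙ g ≗ -ᶠ (f ∙ g)
  ∙-negˡ f g w = begin
    ((-ᶠ f) ∙ g) w        ≡⟨ ∙-cong (λ v → sym (-1*x≈-x (f v))) (λ _ → refl) w ⟩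
    (((- 1ℚ) *ᶠ f) ∙ g) w ≡⟨ ∙-scaleˡ (- 1ℚ) f g w ⟩
    - 1ℚ * (f ∙ g) w      ≡⟨ -1*x≈-x _ ⟩
    - (f ∙ g) w           ∎
    where open ≡-Reasoning

  ∙-negʳ : ∀ f g → f ∙ (-ᶠ g) ≗ -ᶠ (f ∙ g)
  ∙-negʳ f g w = begin
    (f ∙ (-ᶠ g)) w        ≡⟨ ∙-cong (λ _ → refl) (λ v → sym (-1*x≈-x (g v))) w ⟩
    (f ∙ ((- 1ℚ) *ᶠ g)) w ≡⟨ ∙-scaleʳ (- 1ℚ) f g w ⟩
    - 1ℚ * (f ∙ g) w      ≡⟨ -1*x≈-x _ ⟩
    - (f ∙ g) w           ∎
    where open ≡-Reasoning

·-cong : ∀ {f f′ g g′} → f ≗ f′ → g ≗ g′ → f · g ≗ f′ · g′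
·-cong ef eg [] = cong₂ _*_ (ef []) (eg [])
·-cong ef eg (c ∷ w) = cong₂ _+_ (cong₂ _*_ (ef []) (eg (c ∷ w))) (·-cong (λ v → ef (c ∷ v)) eg w)

·-distribʳ : ∀ f f′ g → (f +ᶠ f′) · g ≗ f · g +ᶠ f′ · g
·-distribʳ f f′ g [] = *-distribʳ-+ (g []) (f []) (f′ [])
·-distribʳ f f′ g (c ∷ w) =
  trans (cong₂ _+_ (*-distribʳ-+ (g (c ∷ w)) (f []) (f′ [])) (·-distribʳ (∂ c f) (∂ c f′) g w))
        (interchange (f [] * g (c ∷ w)) (f′ [] * g (c ∷ w)) _ _)

·-distribˡ : ∀ f g g′ → f · (g +ᶠ g′) ≗ f · g +ᶠ f · g′
·-distribˡ f g g′ [] = *-distribˡ-+ (f []) (g []) (g′ [])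
·-distribˡ f g g′ (c ∷ w) =
  trans (cong₂ _+_ (*-distribˡ-+ (f []) (g (c ∷ w)) (g′ (c ∷ w))) (·-distribˡ (∂ c f) g g′ w))
        (interchange (f [] * g (c ∷ w)) (f [] * g′ (c ∷ w)) _ _)

·-scaleˡ : ∀ k f g → (k *ᶠ f) · g ≗ k *ᶠ (f · g)
·-scaleˡ k f g [] = *-assoc k (f []) (g [])
·-scaleˡ k f g (c ∷ w) =
  trans (cong₂ _+_ (*-assoc k (f []) (g (c ∷ w))) (·-scaleˡ k (∂ c f) g w)) (sym (*-distribˡ-+ k _ _))

·-scaleʳ : ∀ k f g → f · (k *ᶠ g) ≗ k *ᶠ (f · g)
·-scaleʳ k f g [] = x∙yz≈y∙xz (f []) k (g [])
·-scaleʳ k f g (c ∷ w) =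
  trans (cong₂ _+_ (x∙yz≈y∙xz (f []) k (g (c ∷ w))) (·-scaleʳ k (∂ c f) g w)) (sym (*-distribˡ-+ k _ _))

·-isBilinear : IsBilinear _·_
·-isBilinear = record
  { ∙-cong = ·-cong ; ∙-distribʳ = ·-distribʳ ; ∙-distribˡ = ·-distribˡ ; ∙-scaleˡ = ·-scaleˡ ; ∙-scaleʳ = ·-scaleʳ }

ш-cong : ∀ {f f′ g g′} → f ≗ f′ → g ≗ g′ → f ш g ≗ f′ ш g′
ш-cong ef eg [] = cong₂ _*_ (ef []) (eg [])
ш-cong ef eg (c ∷ w) = cong₂ _+_ (ш-cong (λ v → ef (c ∷ v)) eg w) (ш-cong ef (λ v → eg (c ∷ v)) w)

ш-distribʳ : ∀ f f′ g → (f +ᶠ f′) ш g ≗ f ш g +ᶠ f′ ш g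
ш-distribʳ f f′ g [] = *-distribʳ-+ (g []) (f []) (f′ [])
ш-distribʳ f f′ g (c ∷ w) =
  trans (cong₂ _+_ (ш-distribʳ (∂ c f) (∂ c f′) g w) (ш-distribʳ f f′ (∂ c g) w))
        (interchange ((∂ c f ш g) w) _ _ _)

ш-distribˡ : ∀ f g g′ → f ш (g +ᶠ g′) ≗ f ш g +ᶠ f ш g′
ш-distribˡ f g g′ [] = *-distribˡ-+ (f []) (g []) (g′ [])
ш-distribˡ f g g′ (c ∷ w) =
  trans (cong₂ _+_ (ш-distribˡ (∂ c f) g g′ w) (ш-distribˡ f (∂ c g) (∂ c g′) w))
        (interchange ((∂ c f ш g) w) _ _ _)

ш-scaleˡ : ∀ k f g → (k *ᶠ f) ш g ≗ k *ᶠ (f ш g)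
ш-scaleˡ k f g [] = *-assoc k (f []) (g [])
ш-scaleˡ k f g (c ∷ w) =
  trans (cong₂ _+_ (ш-scaleˡ k (∂ c f) g w) (ш-scaleˡ k f (∂ c g) w)) (sym (*-distribˡ-+ k _ _))

ш-scaleʳ : ∀ k f g → f ш (k *ᶠ g) ≗ k *ᶠ (f ш g)
ш-scaleʳ k f g [] = x∙yz≈y∙xz (f []) k (g [])
ш-scaleʳ k f g (c ∷ w) =
  trans (cong₂ _+_ (ш-scaleʳ k (∂ c f) g w) (ш-scaleʳ k f (∂ c g) w)) (sym (*-distribˡ-+ k _ _))

ш-isBilinear : IsBilinear _ш_
ш-isBilinear = record
  { ∙-cong = ш-cong ; ∙-distribʳ = ш-distribʳ ; ∙-distribˡ = ш-distribˡ ; ∙-scaleˡ = ш-scaleˡ ; ∙-scaleʳ = ш-scaleʳ }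

open IsBilinear ·-isBilinear using () renaming (∙-zeroˡ to ·-zeroˡ; ∙-zeroʳ to ·-zeroʳ)
open IsBilinear ш-isBilinear using () renaming (∙-zeroˡ to ш-zeroˡ; ∙-zeroʳ to ш-zeroʳ)

·-constˡ : ∀ {f} g → (∀ c → ∂ c f ≗ 0ᶠ) → f · g ≗ f [] *ᶠ g
·-constˡ g ∂f≗0 [] = refl
·-constˡ {f} g ∂f≗0 (c ∷ w) = trans (cong (f [] * g (c ∷ w) +_) (·-zeroˡ g (∂f≗0 c) w)) (+-identityʳ _)

indicator : Word → Coeffs
indicator v u = if eqW v u then 1ℚ else 0ℚ

∂-indicator : ∀ a v c → ∂ c (indicator (a ∷ v)) ≗ (λ u → if eqL a c then indicator v u else 0ℚ)
∂-indicator x v x u = refl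
∂-indicator x v y u = refl
∂-indicator y v x u = refl
∂-indicator y v y u = refl

if-zero : ∀ (t : Bool) {p q : ℚ} → p ≡ q → (if t then p else 0ℚ) ≡ (if t then q else 0ℚ)
if-zero t e = cong (λ r → if t then r else 0ℚ) e

·-identityˡ : ∀ g → indicator [] · g ≗ g
·-identityˡ g w = trans (·-constˡ g (λ c _ → refl) w) (*-identityˡ (g w))

·-ifˡ : ∀ (t : Bool) f g → (λ u → if t then f u else 0ℚ) · g ≗ (λ w → if t then (f · g) w else 0ℚ)
·-ifˡ true f g w = refl
·-ifˡ false f g w = ·-zeroˡ g (λ _ → refl) w

·-indicator : ∀ v v′ → indicator v · indicator v′ ≗ indicator (v ++ v′)
·-indicator [] v′ w = ·-identityˡ (indicator v′) w
·-indicator (a ∷ v) v′ [] = *-zeroˡ (indicator v′ [])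
·-indicator (a ∷ v) v′ (c ∷ w) = begin
  0ℚ * indicator v′ (c ∷ w) + (∂ c (indicator (a ∷ v)) · indicator v′) w
    ≡⟨ cong₂ _+_ (*-zeroˡ (indicator v′ (c ∷ w))) (·-cong (∂-indicator a v c) (λ _ → refl) w) ⟩
  0ℚ + ((λ u → if eqL a c then indicator v u else 0ℚ) · indicator v′) w
    ≡⟨ +-identityˡ _ ⟩
  ((λ u → if eqL a c then indicator v u else 0ℚ) · indicator v′) w
    ≡⟨ ·-ifˡ (eqL a c) (indicator v) (indicator v′) w ⟩
  (if eqL a c then (indicator v · indicator v′) w else 0ℚ)
    ≡⟨ if-zero (eqL a c) (·-indicator v v′ w) ⟩
  (if eqL a c then indicator (v ++ v′) w else 0ℚ)
    ≡˘⟨ ∂-indicator a (v ++ v′) c w ⟩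
  indicator (a ∷ v ++ v′) (c ∷ w) ∎
  where open ≡-Reasoning

ш-identityˡ : ∀ g → indicator [] ш g ≗ g
ш-identityˡ g [] = *-identityˡ (g [])
ш-identityˡ g (c ∷ w) =
  trans (cong₂ _+_ (ш-zeroˡ g (λ _ → refl) w) (ш-identityˡ (∂ c g) w)) (+-identityˡ _)

ш-identityʳ : ∀ f → f ш indicator [] ≗ f
ш-identityʳ f [] = *-identityʳ (f [])
ш-identityʳ f (c ∷ w) =
  trans (cong₂ _+_ (ш-identityʳ (∂ c f) w) (ш-zeroʳ f (λ _ → refl) w)) (+-identityʳ _)

ш-ifˡ : ∀ (t : Bool) f g → (λ u → if t then f u else 0ℚ) ш g ≗ (λ w → if t then (f ш g) w else 0ℚ)
ш-ifˡ true f g w = refl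
ш-ifˡ false f g w = ш-zeroˡ g (λ _ → refl) w

ш-ifʳ : ∀ (t : Bool) f g → f ш (λ u → if t then g u else 0ℚ) ≗ (λ w → if t then (f ш g) w else 0ℚ)
ш-ifʳ true f g w = refl
ш-ifʳ false f g w = ш-zeroʳ f (λ _ → refl) w

coeff-++ : ∀ p q → coeff (p ++ q) ≗ coeff p +ᶠ coeff q
coeff-++ [] q w = sym (+-identityˡ _)
coeff-++ ((c , v) ∷ p) q w =
  trans (cong ((if eqW v w then c else 0ℚ) +_) (coeff-++ p q w)) (sym (+-assoc (if eqW v w then c else 0ℚ) _ _))

coeff-++-[] : ∀ p → coeff (p ++ []) ≗ coeff p
coeff-++-[] p w = cong (λ r → coeff r w) (++-identityʳ p)

coeff-pscale : ∀ k p → coeff (pscale k p) ≗ k *ᶠ coeff p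
coeff-pscale k [] w = sym (*-zeroʳ k)
coeff-pscale k ((d , v) ∷ p) w with eqW v w
... | true = trans (cong (k * d +_) (coeff-pscale k p w)) (sym (*-distribˡ-+ k d _))
... | false = trans (cong₂ _+_ (sym (*-zeroʳ k)) (coeff-pscale k p w)) (sym (*-distribˡ-+ k 0ℚ _))

coeff-term : ∀ k v → coeff ((k , v) ∷ []) ≗ k *ᶠ indicator v
coeff-term k v u with eqW v u
... | true = trans (+-identityʳ k) (sym (*-identityʳ k))
... | false = trans (+-identityʳ 0ℚ) (sym (*-zeroʳ k))

coeff-single : ∀ v → coeff ((1ℚ , v) ∷ []) ≗ indicator v
coeff-single v u = +-identityʳ _

coeff-prefix-ε : ∀ a p → coeff (prefix a p) [] ≡ 0ℚ
coeff-prefix-ε a [] = refl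
coeff-prefix-ε a ((d , u) ∷ p) = trans (+-identityˡ _) (coeff-prefix-ε a p)

coeff-prefix : ∀ a p c w → coeff (prefix a p) (c ∷ w) ≡ (if eqL a c then coeff p w else 0ℚ)
coeff-prefix a [] c w with eqL a c
... | true = refl
... | false = refl
coeff-prefix a ((d , u) ∷ p) c w with eqL a c | coeff-prefix a p c w
... | true | ih = cong ((if eqW u w then d else 0ℚ) +_) ih
... | false | ih = trans (+-identityˡ _) ih

coeff-pmul-term : ∀ k v q → coeff (pmul ((k , v) ∷ []) q) ≗ coeff ((k , v) ∷ []) · coeff q
coeff-pmul-term k v [] w = sym (·-zeroʳ (coeff ((k , v) ∷ [])) (λ _ → refl) w)
coeff-pmul-term k v ((d , v′) ∷ q) w = begin
  coeff (S ∷ rest ++ []) w                     ≡⟨ coeff-++ (S ∷ []) (rest ++ []) w ⟩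
  coeff (S ∷ []) w + coeff (rest ++ []) w      ≡⟨ cong₂ _+_ term (coeff-pmul-term k v q w) ⟩
  (F · D) w + (F · coeff q) w                  ≡˘⟨ ·-distribˡ F D (coeff q) w ⟩
  (F · (D +ᶠ coeff q)) w                       ≡˘⟨ ·-cong (λ _ → refl) (coeff-++ ((d , v′) ∷ []) q) w ⟩
  (F · coeff ((d , v′) ∷ q)) w                 ∎
  where
  open ≡-Reasoning
  S = (k * d , v ++ v′)
  rest = map (λ { (d′ , v″) → (k * d′ , v ++ v″) }) q
  F = coeff ((k , v) ∷ [])
  D = coeff ((d , v′) ∷ [])
  term : coeff (S ∷ []) w ≡ (F · D) w
  term = begin
    coeff (S ∷ []) w                           ≡⟨ coeff-term (k * d) (v ++ v′) w ⟩
    k * d * indicator (v ++ v′) w              ≡˘⟨ cong (k * d *_) (·-indicator v v′ w) ⟩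
    k * d * (indicator v · indicator v′) w     ≡⟨ *-assoc k d _ ⟩
    k * (d * (indicator v · indicator v′) w)   ≡˘⟨ cong (k *_) (·-scaleʳ d (indicator v) (indicator v′) w) ⟩
    k * (indicator v · (d *ᶠ indicator v′)) w  ≡˘⟨ ·-scaleˡ k (indicator v) (d *ᶠ indicator v′) w ⟩
    ((k *ᶠ indicator v) · (d *ᶠ indicator v′)) w ≡˘⟨ ·-cong (coeff-term k v) (coeff-term d v′) w ⟩
    (F · D) w                                  ∎

coeff-pmul : ∀ p q → coeff (pmul p q) ≗ coeff p · coeff q
coeff-pmul [] q w = sym (·-zeroˡ (coeff q) (λ _ → refl) w)
coeff-pmul ((k , v) ∷ p) q w = begin
  coeff (S ++ pmul p q) w                              ≡⟨ coeff-++ S (pmul p q) w ⟩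
  coeff S w + coeff (pmul p q) w                       ≡˘⟨ cong (_+ coeff (pmul p q) w) (coeff-++-[] S w) ⟩
  coeff (pmul ((k , v) ∷ []) q) w + coeff (pmul p q) w ≡⟨ cong₂ _+_ (coeff-pmul-term k v q w) (coeff-pmul p q w) ⟩
  (T · coeff q) w + (coeff p · coeff q) w              ≡˘⟨ ·-distribʳ T (coeff p) (coeff q) w ⟩
  ((T +ᶠ coeff p) · coeff q) w                         ≡˘⟨ ·-cong (coeff-++ ((k , v) ∷ []) p) (λ _ → refl) w ⟩
  (coeff ((k , v) ∷ p) · coeff q) w                    ∎
  where
  open ≡-Reasoning
  S = map (λ { (d , v′) → (k * d , v ++ v′) }) q
  T = coeff ((k , v) ∷ [])

coeff-shw : ∀ v v′ → coeff (shw v v′) ≗ indicator v ш indicator v′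
coeff-shw [] v′ w = trans (coeff-single v′ w) (sym (ш-identityˡ (indicator v′) w))
coeff-shw (a ∷ v) [] w = trans (coeff-single (a ∷ v) w) (sym (ш-identityʳ (indicator (a ∷ v)) w))
coeff-shw (a ∷ v) (b ∷ v′) [] =
  trans (coeff-++ (prefix a (shw v (b ∷ v′))) (prefix b (shw (a ∷ v) v′)) [])
        (trans (cong₂ _+_ (coeff-prefix-ε a (shw v (b ∷ v′))) (coeff-prefix-ε b (shw (a ∷ v) v′)))
               (trans (+-identityˡ 0ℚ) (sym (*-zeroˡ 0ℚ))))
coeff-shw (a ∷ v) (b ∷ v′) (c ∷ w) = begin
  coeff (prefix a (shw v (b ∷ v′)) ++ prefix b (shw (a ∷ v) v′)) (c ∷ w)
    ≡⟨ coeff-++ (prefix a (shw v (b ∷ v′))) (prefix b (shw (a ∷ v) v′)) (c ∷ w) ⟩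
  coeff (prefix a (shw v (b ∷ v′))) (c ∷ w) + coeff (prefix b (shw (a ∷ v) v′)) (c ∷ w)
    ≡⟨ cong₂ _+_ (coeff-prefix a (shw v (b ∷ v′)) c w) (coeff-prefix b (shw (a ∷ v) v′) c w) ⟩
  (if eqL a c then coeff (shw v (b ∷ v′)) w else 0ℚ) + (if eqL b c then coeff (shw (a ∷ v) v′) w else 0ℚ)
    ≡⟨ cong₂ _+_ (if-zero (eqL a c) (coeff-shw v (b ∷ v′) w)) (if-zero (eqL b c) (coeff-shw (a ∷ v) v′ w)) ⟩
  (if eqL a c then (δv ш δbv′) w else 0ℚ) + (if eqL b c then (δav ш δv′) w else 0ℚ)
    ≡˘⟨ cong₂ _+_ (trans (ш-cong (∂-indicator a v c) (λ _ → refl) w) (ш-ifˡ (eqL a c) δv δbv′ w))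
                  (trans (ш-cong (λ _ → refl) (∂-indicator b v′ c) w) (ш-ifʳ (eqL b c) δav δv′ w)) ⟩
  (∂ c δav ш δbv′) w + (δav ш ∂ c δbv′) w ∎
  where
  open ≡-Reasoning
  δv = indicator v
  δv′ = indicator v′
  δav = indicator (a ∷ v)
  δbv′ = indicator (b ∷ v′)

coeff-psh-term : ∀ k v q → coeff (psh ((k , v) ∷ []) q) ≗ coeff ((k , v) ∷ []) ш coeff q
coeff-psh-term k v [] w = sym (ш-zeroʳ (coeff ((k , v) ∷ [])) (λ _ → refl) w)
coeff-psh-term k v ((d , v′) ∷ q) w = begin
  coeff ((S ++ rest) ++ []) w                  ≡⟨ coeff-++-[] (S ++ rest) w ⟩
  coeff (S ++ rest) w                          ≡⟨ coeff-++ S rest w ⟩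
  coeff S w + coeff rest w                     ≡˘⟨ cong (coeff S w +_) (coeff-++-[] rest w) ⟩
  coeff S w + coeff (psh ((k , v) ∷ []) q) w   ≡⟨ cong₂ _+_ term (coeff-psh-term k v q w) ⟩
  (F ш D) w + (F ш coeff q) w                  ≡˘⟨ ш-distribˡ F D (coeff q) w ⟩
  (F ш (D +ᶠ coeff q)) w                       ≡˘⟨ ш-cong (λ _ → refl) (coeff-++ ((d , v′) ∷ []) q) w ⟩
  (F ш coeff ((d , v′) ∷ q)) w                 ∎
  where
  open ≡-Reasoning
  S = pscale (k * d) (shw v v′)
  rest = concatMap (λ { (d′ , v″) → pscale (k * d′) (shw v v″) }) q
  F = coeff ((k , v) ∷ [])
  D = coeff ((d , v′) ∷ [])
  term : coeff S w ≡ (F ш D) w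
  term = begin
    coeff S w                                  ≡⟨ coeff-pscale (k * d) (shw v v′) w ⟩
    k * d * coeff (shw v v′) w                 ≡⟨ cong (k * d *_) (coeff-shw v v′ w) ⟩
    k * d * (indicator v ш indicator v′) w     ≡⟨ *-assoc k d _ ⟩
    k * (d * (indicator v ш indicator v′) w)   ≡˘⟨ cong (k *_) (ш-scaleʳ d (indicator v) (indicator v′) w) ⟩
    k * (indicator v ш (d *ᶠ indicator v′)) w  ≡˘⟨ ш-scaleˡ k (indicator v) (d *ᶠ indicator v′) w ⟩
    ((k *ᶠ indicator v) ш (d *ᶠ indicator v′)) w ≡˘⟨ ш-cong (coeff-term k v) (coeff-term d v′) w ⟩
    (F ш D) w                                  ∎

coeff-psh : ∀ p q → coeff (psh p q) ≗ coeff p ш coeff q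
coeff-psh [] q w = sym (ш-zeroˡ (coeff q) (λ _ → refl) w)
coeff-psh ((k , v) ∷ p) q w = begin
  coeff (S ++ psh p q) w                              ≡⟨ coeff-++ S (psh p q) w ⟩
  coeff S w + coeff (psh p q) w                       ≡˘⟨ cong (_+ coeff (psh p q) w) (coeff-++-[] S w) ⟩
  coeff (psh ((k , v) ∷ []) q) w + coeff (psh p q) w  ≡⟨ cong₂ _+_ (coeff-psh-term k v q w) (coeff-psh p q w) ⟩
  (T ш coeff q) w + (coeff p ш coeff q) w             ≡˘⟨ ш-distribʳ T (coeff p) (coeff q) w ⟩
  ((T +ᶠ coeff p) ш coeff q) w                        ≡˘⟨ ш-cong (coeff-++ ((k , v) ∷ []) p) (λ _ → refl) w ⟩
  (coeff ((k , v) ∷ p) ш coeff q) w                   ∎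
  where
  open ≡-Reasoning
  S = concatMap (λ { (d , v′) → pscale (k * d) (shw v v′) }) q
  T = coeff ((k , v) ∷ [])

record IsAdditive (A : Poly → ℚ) : Set where
  field
    []-zero : A [] ≡ 0ℚ
    ++-homo : ∀ p q → A (p ++ q) ≡ A p + A q

  concatMap-applyUpTo : ∀ {X : Set} (h : X → Poly) (f : ℕ → X) n →
    A (concatMap h (applyUpTo f n)) ≡ sum< (λ m → A (h (f m))) n
  concatMap-applyUpTo h f zero = []-zero
  concatMap-applyUpTo h f (suc n) =
    trans (++-homo (h (f 0)) _) (cong (A (h (f 0)) +_) (concatMap-applyUpTo h (λ m → f (suc m)) n))

  concatMap-antidiagonal² : ∀ (H : ℕ → ℕ → ℕ → ℕ → Poly) a b →
    A (concatMap (λ i → concatMap (λ j → H i j (a ∸ i) (b ∸ j)) (upTo (suc b))) (upTo (suc a)))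
    ≡ antidiagonal² (λ i j k l → A (H i j k l)) a b
  concatMap-antidiagonal² H a b = begin
    A (concatMap (λ i → concatMap (λ j → H i j (a ∸ i) (b ∸ j)) (upTo (suc b))) (upTo (suc a)))
      ≡⟨ concatMap-applyUpTo (λ i → concatMap (λ j → H i j (a ∸ i) (b ∸ j)) (upTo (suc b))) (λ i → i) (suc a) ⟩
    sum< (λ i → A (concatMap (λ j → H i j (a ∸ i) (b ∸ j)) (upTo (suc b)))) (suc a)
      ≡⟨ sum<-cong (suc a) (λ i → concatMap-applyUpTo (λ j → H i j (a ∸ i) (b ∸ j)) (λ j → j) (suc b)) ⟩
    sum< (λ i → sum< (λ j → A (H i j (a ∸ i) (b ∸ j))) (suc b)) (suc a)
      ≡⟨ sum<-cong (suc a) (λ i → sum<-antidiagonal (λ j l → A (H i j (a ∸ i) l)) b) ⟩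
    sum< (λ i → antidiagonal (λ j l → A (H i j (a ∸ i) l)) b) (suc a)
      ≡⟨ sum<-antidiagonal (λ i k → antidiagonal (λ j l → A (H i j k l)) b) a ⟩
    antidiagonal² (λ i j k l → A (H i j k l)) a b ∎
    where open ≡-Reasoning

coeff-isAdditive : ∀ w → IsAdditive (λ p → coeff p w)
coeff-isAdditive w = record { []-zero = refl ; ++-homo = λ p q → coeff-++ p q w }

-- F a b w is the coefficient of w Y^a Z^b.
CoeffSeries : Set
CoeffSeries = ℕ → ℕ → Coeffs

⟦_⟧ : Ser → CoeffSeries
⟦ S ⟧ a b = coeff (S a b)

infix 4 _≋_
_≋_ : CoeffSeries → CoeffSeries → Set
F ≋ G = ∀ a b → F a b ≗ G a b

0ˢ : CoeffSeries
0ˢ a b = 0ᶠ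

_+ˢ_ : CoeffSeries → CoeffSeries → CoeffSeries
(F +ˢ G) a b = F a b +ᶠ G a b

_*ˢ_ : ℚ → CoeffSeries → CoeffSeries
(k *ˢ F) a b = k *ᶠ F a b

-ˢ_ : CoeffSeries → CoeffSeries
(-ˢ F) a b = -ᶠ F a b

infixl 6 _+ˢ_
infixl 7 _*ˢ_

∂ˢ : Letter → CoeffSeries → CoeffSeries
∂ˢ c F a b = ∂ c (F a b)

mulY : CoeffSeries → CoeffSeries
mulY F zero b = 0ᶠ
mulY F (suc a) b = F a b

mulZ : CoeffSeries → CoeffSeries
mulZ F a zero = 0ᶠ
mulZ F a (suc b) = F a b

mulY-cong : ∀ {F G w} → (∀ a b → F a b w ≡ G a b w) → ∀ a b → mulY F a b w ≡ mulY G a b w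
mulY-cong e zero b = refl
mulY-cong e (suc a) b = e a b

mulZ-cong : ∀ {F G w} → (∀ a b → F a b w ≡ G a b w) → ∀ a b → mulZ F a b w ≡ mulZ G a b w
mulZ-cong e a zero = refl
mulZ-cong e a (suc b) = e a b

δ₀ : ℕ → ℕ → ℚ
δ₀ zero zero = 1ℚ
δ₀ _ _ = 0ℚ

antidiagonal²-δ₀ : ∀ (h : ℕ → ℕ → ℚ) a b → antidiagonal² (λ i j k l → δ₀ i j * h k l) a b ≡ h a b
antidiagonal²-δ₀ h a b =
  trans (antidiagonal-first a (λ i k → antidiagonal-zero b (λ j l → *-zeroˡ (h k l))))
        (trans (antidiagonal-first b (λ j l → *-zeroˡ (h a l))) (*-identityˡ (h a b)))

antidiagonal²-δ₀-δ₀ : ∀ {f g : ℕ → ℕ → ℚ} → (∀ i j → f i j ≡ δ₀ i j) → (∀ k l → g k l ≡ δ₀ k l) →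
  ∀ a b → antidiagonal² (λ i j k l → f i j * g k l) a b ≡ δ₀ a b
antidiagonal²-δ₀-δ₀ {f} {g} f≡δ₀ g≡δ₀ a b =
  trans (antidiagonal²-cong a b (λ i j k l → cong₂ _*_ (f≡δ₀ i j) (g≡δ₀ k l))) (antidiagonal²-δ₀ δ₀ a b)

convolve : (Coeffs → Coeffs → Coeffs) → CoeffSeries → CoeffSeries → CoeffSeries
convolve _∙_ F H a b w = antidiagonal² (λ i j k l → (F i j ∙ H k l) w) a b

⟦smul⟧ : ∀ S T → ⟦ smul S T ⟧ ≋ convolve _·_ ⟦ S ⟧ ⟦ T ⟧
⟦smul⟧ S T a b w =
  trans (IsAdditive.concatMap-antidiagonal² (coeff-isAdditive w) (λ i j k l → pmul (S i j) (T k l)) a b)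
        (antidiagonal²-cong a b (λ i j k l → coeff-pmul (S i j) (T k l) w))

⟦ssh⟧ : ∀ S T → ⟦ ssh S T ⟧ ≋ convolve _ш_ ⟦ S ⟧ ⟦ T ⟧
⟦ssh⟧ S T a b w =
  trans (IsAdditive.concatMap-antidiagonal² (coeff-isAdditive w) (λ i j k l → psh (S i j) (T k l)) a b)
        (antidiagonal²-cong a b (λ i j k l → coeff-psh (S i j) (T k l) w))

⟦geom⟧ : ∀ u a b w → ⟦ geom u ⟧ a b w ≡ sum< (λ m → ⟦ spow u m ⟧ a b w) (suc (a +ℕ b))
⟦geom⟧ u a b w = IsAdditive.concatMap-applyUpTo (coeff-isAdditive w) (λ m → spow u m a b) (λ m → m) (suc (a +ℕ b))

module Convolution {_∙_ : Coeffs → Coeffs → Coeffs} (bilinear : IsBilinear _∙_) where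
  open IsBilinear bilinear

  infixl 7 _⋆_
  _⋆_ : CoeffSeries → CoeffSeries → CoeffSeries
  _⋆_ = convolve _∙_

  ⋆-congˡ : ∀ {F F′} H → F ≋ F′ → F ⋆ H ≋ F′ ⋆ H
  ⋆-congˡ H eF a b w = antidiagonal²-cong a b (λ i j k l → ∙-cong (eF i j) (λ _ → refl) w)

  ⋆-congʳ : ∀ F {H H′} → H ≋ H′ → F ⋆ H ≋ F ⋆ H′
  ⋆-congʳ F eH a b w = antidiagonal²-cong a b (λ i j k l → ∙-cong (λ _ → refl) (eH k l) w)

  ⋆-zeroˡ : ∀ F H → F ≋ 0ˢ → F ⋆ H ≋ 0ˢ
  ⋆-zeroˡ F H F≋0 a b w = antidiagonal²-zero a b (λ i j k l → ∙-zeroˡ (H k l) (F≋0 i j) w)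

  ⋆-zeroʳ : ∀ F H → H ≋ 0ˢ → F ⋆ H ≋ 0ˢ
  ⋆-zeroʳ F H H≋0 a b w = antidiagonal²-zero a b (λ i j k l → ∙-zeroʳ (F i j) (H≋0 k l) w)

  ⋆-distribʳ : ∀ F F′ H → (F +ˢ F′) ⋆ H ≋ F ⋆ H +ˢ F′ ⋆ H
  ⋆-distribʳ F F′ H a b w =
    trans (antidiagonal²-cong a b (λ i j k l → ∙-distribʳ (F i j) (F′ i j) (H k l) w))
          (antidiagonal²-+ (λ i j k l → (F i j ∙ H k l) w) (λ i j k l → (F′ i j ∙ H k l) w) a b)

  ⋆-distribˡ : ∀ F H H′ → F ⋆ (H +ˢ H′) ≋ F ⋆ H +ˢ F ⋆ H′
  ⋆-distribˡ F H H′ a b w =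
    trans (antidiagonal²-cong a b (λ i j k l → ∙-distribˡ (F i j) (H k l) (H′ k l) w))
          (antidiagonal²-+ (λ i j k l → (F i j ∙ H k l) w) (λ i j k l → (F i j ∙ H′ k l) w) a b)

  ⋆-scaleʳ : ∀ c F H → F ⋆ (c *ˢ H) ≋ c *ˢ (F ⋆ H)
  ⋆-scaleʳ c F H a b w =
    trans (antidiagonal²-cong a b (λ i j k l → ∙-scaleʳ c (F i j) (H k l) w))
          (antidiagonal²-scale c (λ i j k l → (F i j ∙ H k l) w) a b)

  ⋆-negˡ : ∀ F H → (-ˢ F) ⋆ H ≋ -ˢ (F ⋆ H)
  ⋆-negˡ F H a b w =
    trans (antidiagonal²-cong a b (λ i j k l → trans (∙-negˡ (F i j) (H k l) w) (sym (-1*x≈-x _))))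
          (trans (antidiagonal²-scale (- 1ℚ) (λ i j k l → (F i j ∙ H k l) w) a b) (-1*x≈-x _))

  ⋆-negʳ : ∀ F H → F ⋆ (-ˢ H) ≋ -ˢ (F ⋆ H)
  ⋆-negʳ F H a b w =
    trans (antidiagonal²-cong a b (λ i j k l → trans (∙-negʳ (F i j) (H k l) w) (sym (-1*x≈-x _))))
          (trans (antidiagonal²-scale (- 1ℚ) (λ i j k l → (F i j ∙ H k l) w) a b) (-1*x≈-x _))

  ⋆-mulYˡ : ∀ F H → mulY F ⋆ H ≋ mulY (F ⋆ H)
  ⋆-mulYˡ F H zero b w = antidiagonal-zero b (λ j l → ∙-zeroˡ (H 0 l) (λ _ → refl) w)
  ⋆-mulYˡ F H (suc a) b w =
    antidiagonal-shiftˡ {λ i k → antidiagonal (λ j l → (mulY F i j ∙ H k l) w) b} a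
      (λ k → antidiagonal-zero b (λ j l → ∙-zeroˡ (H k l) (λ _ → refl) w))

  ⋆-mulYʳ : ∀ F H → F ⋆ mulY H ≋ mulY (F ⋆ H)
  ⋆-mulYʳ F H zero b w = antidiagonal-zero b (λ j l → ∙-zeroʳ (F 0 j) (λ _ → refl) w)
  ⋆-mulYʳ F H (suc a) b w =
    antidiagonal-shiftʳ {λ i k → antidiagonal (λ j l → (F i j ∙ mulY H k l) w) b} a
      (λ i → antidiagonal-zero b (λ j l → ∙-zeroʳ (F i j) (λ _ → refl) w))

  ⋆-mulZˡ : ∀ F H → mulZ F ⋆ H ≋ mulZ (F ⋆ H)
  ⋆-mulZˡ F H a zero w = antidiagonal-zero a (λ i k → ∙-zeroˡ (H k 0) (λ _ → refl) w)
  ⋆-mulZˡ F H a (suc b) w =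
    antidiagonal-cong a (λ i k →
      antidiagonal-shiftˡ {λ j l → (mulZ F i j ∙ H k l) w} b (λ l → ∙-zeroˡ (H k l) (λ _ → refl) w))

  ⋆-Z-freeˡ : ∀ F H → (∀ i j → F i (suc j) ≗ 0ᶠ) →
    ∀ a b w → (F ⋆ H) a b w ≡ antidiagonal (λ i k → (F i 0 ∙ H k b) w) a
  ⋆-Z-freeˡ F H F-Z-free a b w =
    antidiagonal-cong a (λ i k → antidiagonal-first b (λ j l → ∙-zeroˡ (H k l) (F-Z-free i j) w))

open Convolution ·-isBilinear using ()
  renaming ( _⋆_ to _⋆·_; ⋆-congˡ to ⋆·-congˡ; ⋆-congʳ to ⋆·-congʳ; ⋆-zeroˡ to ⋆·-zeroˡ; ⋆-zeroʳ to ⋆·-zeroʳ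
           ; ⋆-distribʳ to ⋆·-distribʳ; ⋆-distribˡ to ⋆·-distribˡ; ⋆-scaleʳ to ⋆·-scaleʳ; ⋆-negˡ to ⋆·-negˡ
           ; ⋆-mulYˡ to ⋆·-mulYˡ; ⋆-mulZˡ to ⋆·-mulZˡ; ⋆-Z-freeˡ to ⋆·-Z-freeˡ)
open Convolution ш-isBilinear using ()
  renaming ( _⋆_ to _⋆ш_; ⋆-congˡ to ⋆ш-congˡ; ⋆-congʳ to ⋆ш-congʳ; ⋆-zeroʳ to ⋆ш-zeroʳ; ⋆-negʳ to ⋆ш-negʳ
           ; ⋆-mulYʳ to ⋆ш-mulYʳ; ⋆-mulZˡ to ⋆ш-mulZˡ)

⋆·-∂ : ∀ F H c a b w →
  ∂ˢ c (F ⋆· H) a b w ≡ antidiagonal² (λ i j k l → F i j [] * H k l (c ∷ w)) a b + (∂ˢ c F ⋆· H) a b w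
⋆·-∂ F H c a b w =
  antidiagonal²-+ (λ i j k l → F i j [] * H k l (c ∷ w)) (λ i j k l → (∂ c (F i j) · H k l) w) a b

⋆·-ε-zeroˡ : ∀ F H → (∀ i j → F i j [] ≡ 0ℚ) → ∀ a b → (F ⋆· H) a b [] ≡ 0ℚ
⋆·-ε-zeroˡ F H F[]≡0 a b =
  antidiagonal²-zero a b (λ i j k l → trans (cong (_* H k l []) (F[]≡0 i j)) (*-zeroˡ (H k l [])))

⋆·-∂-zeroˡ : ∀ F H → (∀ i j → F i j [] ≡ 0ℚ) → ∀ c → ∂ˢ c (F ⋆· H) ≋ ∂ˢ c F ⋆· H
⋆·-∂-zeroˡ F H F[]≡0 c a b w =
  trans (⋆·-∂ F H c a b w)
        (trans (cong (_+ (∂ˢ c F ⋆· H) a b w) (antidiagonal²-zero a b vanish)) (+-identityˡ _))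
  where
  vanish : ∀ i j k l → F i j [] * H k l (c ∷ w) ≡ 0ℚ
  vanish i j k l = trans (cong (_* H k l (c ∷ w)) (F[]≡0 i j)) (*-zeroˡ (H k l (c ∷ w)))

⋆·-∂-unitˡ : ∀ F H → (∀ i j → F i j [] ≡ δ₀ i j) → ∀ c → ∂ˢ c (F ⋆· H) ≋ ∂ˢ c H +ˢ ∂ˢ c F ⋆· H
⋆·-∂-unitˡ F H F[]≡δ₀ c a b w =
  trans (⋆·-∂ F H c a b w)
        (cong (_+ (∂ˢ c F ⋆· H) a b w)
              (trans (antidiagonal²-cong a b (λ i j k l → cong (_* H k l (c ∷ w)) (F[]≡δ₀ i j)))
                     (antidiagonal²-δ₀ (λ k l → H k l (c ∷ w)) a b)))

⋆ш-∂ : ∀ F H c → ∂ˢ c (F ⋆ш H) ≋ ∂ˢ c F ⋆ш H +ˢ F ⋆ш ∂ˢ c H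
⋆ш-∂ F H c a b w =
  antidiagonal²-+ (λ i j k l → (∂ c (F i j) ш H k l) w) (λ i j k l → (F i j ш ∂ c (H k l)) w) a b

⟦sone⟧-ε : ∀ a b → ⟦ sone ⟧ a b [] ≡ δ₀ a b
⟦sone⟧-ε zero zero = +-identityʳ 1ℚ
⟦sone⟧-ε zero (suc b) = refl
⟦sone⟧-ε (suc a) b = refl

⟦sone⟧-∂ : ∀ c → ∂ˢ c ⟦ sone ⟧ ≋ 0ˢ
⟦sone⟧-∂ c zero zero w = +-identityʳ 0ℚ
⟦sone⟧-∂ c zero (suc b) w = refl
⟦sone⟧-∂ c (suc a) b w = refl

⋆·-sone : ∀ H → ⟦ sone ⟧ ⋆· H ≋ H
⋆·-sone H a b w =
  trans (antidiagonal-first a (λ i k → antidiagonal-zero b (λ j l → ·-zeroˡ (H k l) (λ _ → refl) w)))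
  (trans (antidiagonal-first b (λ j l → ·-zeroˡ (H a l) (λ _ → refl) w))
  (trans (·-cong (coeff-single []) (λ _ → refl) w) (·-identityˡ (H a b) w)))

record Solves (F : CoeffSeries) : Set where
  field
    ε-coeff : ∀ a b → F a b [] ≡ δ₀ a b
    ∂x-eq : ∂ˢ x F ≋ mulZ F
    ∂y-eq : ∂ˢ y F ≋ mulZ F +ˢ -ˢ mulY F

Solves-unique : ∀ {F G} → Solves F → Solves G → F ≋ G
Solves-unique {F} {G} sF sG a b w = agree w a b
  where
  module F = Solves sF
  module G = Solves sG
  agree : ∀ w a b → F a b w ≡ G a b w
  agree [] a b = trans (F.ε-coeff a b) (sym (G.ε-coeff a b))
  agree (x ∷ w) a b = trans (F.∂x-eq a b w) (trans (mulZ-cong (agree w) a b) (sym (G.∂x-eq a b w)))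
  agree (y ∷ w) a b =
    trans (F.∂y-eq a b w)
          (trans (cong₂ (λ p q → p + - q) (mulZ-cong (agree w) a b) (mulY-cong (agree w) a b)) (sym (G.∂y-eq a b w)))

-- Multiplication by Y or Z lowers the total degree by one, matching the truncation of the sum in geom.
sum<-mulY : ∀ (F : ℕ → CoeffSeries) a b w →
  sum< (λ m → mulY (F m) a b w) (a +ℕ b) ≡ mulY (λ a′ b′ w′ → sum< (λ m → F m a′ b′ w′) (suc (a′ +ℕ b′))) a b w
sum<-mulY F zero b w = sum<-zero b (λ _ → refl)
sum<-mulY F (suc a) b w = refl

sum<-mulZ : ∀ (F : ℕ → CoeffSeries) a b w →
  sum< (λ m → mulZ (F m) a b w) (a +ℕ b) ≡ mulZ (λ a′ b′ w′ → sum< (λ m → F m a′ b′ w′) (suc (a′ +ℕ b′))) a b w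
sum<-mulZ F a zero w = sum<-zero (a +ℕ 0) (λ _ → refl)
sum<-mulZ F a (suc b) w = cong (sum< (λ m → F m a b w)) (+-suc a b)

module GeometricSeries (u : Ser) (u-ε : ∀ i j → ⟦ u ⟧ i j [] ≡ 0ℚ) where

  pow-ε : ∀ m a b → ⟦ spow u (suc m) ⟧ a b [] ≡ 0ℚ
  pow-ε m a b = trans (⟦smul⟧ u (spow u m) a b []) (⋆·-ε-zeroˡ ⟦ u ⟧ ⟦ spow u m ⟧ u-ε a b)

  pow-∂ : ∀ m c → ∂ˢ c ⟦ spow u (suc m) ⟧ ≋ ∂ˢ c ⟦ u ⟧ ⋆· ⟦ spow u m ⟧
  pow-∂ m c a b w =
    trans (⟦smul⟧ u (spow u m) a b (c ∷ w)) (⋆·-∂-zeroˡ ⟦ u ⟧ ⟦ spow u m ⟧ u-ε c a b w)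

  geom-ε : ∀ a b → ⟦ geom u ⟧ a b [] ≡ δ₀ a b
  geom-ε a b =
    trans (⟦geom⟧ u a b [])
          (trans (cong₂ _+_ (⟦sone⟧-ε a b) (sum<-zero (a +ℕ b) (λ m → pow-ε m a b))) (+-identityʳ _))

  geom-∂ : ∀ c a b w → ∂ˢ c ⟦ geom u ⟧ a b w ≡ sum< (λ m → ∂ˢ c ⟦ spow u (suc m) ⟧ a b w) (a +ℕ b)
  geom-∂ c a b w =
    trans (⟦geom⟧ u a b (c ∷ w))
          (trans (cong (_+ sum< (λ m → ∂ˢ c ⟦ spow u (suc m) ⟧ a b w) (a +ℕ b)) (⟦sone⟧-∂ c a b w)) (+-identityˡ _))

  geom-∂-zero : ∀ c → (∀ m → ∂ˢ c ⟦ spow u (suc m) ⟧ ≋ 0ˢ) → ∂ˢ c ⟦ geom u ⟧ ≋ 0ˢ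
  geom-∂-zero c ∂pow≋0 a b w = trans (geom-∂ c a b w) (sum<-zero (a +ℕ b) (λ m → ∂pow≋0 m a b w))

  geom-∂-mulZ : ∀ c → (∀ m → ∂ˢ c ⟦ spow u (suc m) ⟧ ≋ mulZ ⟦ spow u m ⟧) → ∂ˢ c ⟦ geom u ⟧ ≋ mulZ ⟦ geom u ⟧
  geom-∂-mulZ c ∂pow a b w = begin
    ∂ˢ c ⟦ geom u ⟧ a b w                                        ≡⟨ geom-∂ c a b w ⟩
    sum< (λ m → ∂ˢ c ⟦ spow u (suc m) ⟧ a b w) (a +ℕ b)          ≡⟨ sum<-cong (a +ℕ b) (λ m → ∂pow m a b w) ⟩
    sum< (λ m → mulZ ⟦ spow u m ⟧ a b w) (a +ℕ b)                ≡⟨ sum<-mulZ (λ m → ⟦ spow u m ⟧) a b w ⟩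
    mulZ (λ a′ b′ w′ → sum< (λ m → ⟦ spow u m ⟧ a′ b′ w′) (suc (a′ +ℕ b′))) a b w
      ≡˘⟨ mulZ-cong (λ a′ b′ → ⟦geom⟧ u a′ b′ w) a b ⟩
    mulZ ⟦ geom u ⟧ a b w                                        ∎
    where open ≡-Reasoning

  geom-∂-mulY : ∀ c → (∀ m → ∂ˢ c ⟦ spow u (suc m) ⟧ ≋ -ˢ mulY ⟦ spow u m ⟧) → ∂ˢ c ⟦ geom u ⟧ ≋ -ˢ mulY ⟦ geom u ⟧
  geom-∂-mulY c ∂pow a b w = begin
    ∂ˢ c ⟦ geom u ⟧ a b w                                        ≡⟨ geom-∂ c a b w ⟩
    sum< (λ m → ∂ˢ c ⟦ spow u (suc m) ⟧ a b w) (a +ℕ b)          ≡⟨ sum<-cong (a +ℕ b) (λ m → ∂pow m a b w) ⟩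
    sum< (λ m → - mulY ⟦ spow u m ⟧ a b w) (a +ℕ b)              ≡⟨ sum<-neg (λ m → mulY ⟦ spow u m ⟧ a b w) (a +ℕ b) ⟩
    - sum< (λ m → mulY ⟦ spow u m ⟧ a b w) (a +ℕ b)              ≡⟨ cong -_ (sum<-mulY (λ m → ⟦ spow u m ⟧) a b w) ⟩
    - mulY (λ a′ b′ w′ → sum< (λ m → ⟦ spow u m ⟧ a′ b′ w′) (suc (a′ +ℕ b′))) a b w
      ≡˘⟨ cong -_ (mulY-cong (λ a′ b′ → ⟦geom⟧ u a′ b′ w) a b) ⟩
    - mulY ⟦ geom u ⟧ a b w                                      ∎
    where open ≡-Reasoning

⟦-yY⟧-ε : ∀ i j → ⟦ sneg yY ⟧ i j [] ≡ 0ℚ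
⟦-yY⟧-ε zero j = refl
⟦-yY⟧-ε (suc zero) zero = refl
⟦-yY⟧-ε (suc zero) (suc j) = refl
⟦-yY⟧-ε (suc (suc i)) j = refl

⟦-yY⟧-∂x : ∂ˢ x ⟦ sneg yY ⟧ ≋ 0ˢ
⟦-yY⟧-∂x zero j w = refl
⟦-yY⟧-∂x (suc zero) zero w = refl
⟦-yY⟧-∂x (suc zero) (suc j) w = refl
⟦-yY⟧-∂x (suc (suc i)) j w = refl

⟦-yY⟧-∂y : ∂ˢ y ⟦ sneg yY ⟧ ≋ -ˢ mulY ⟦ sone ⟧
⟦-yY⟧-∂y zero j w = refl
⟦-yY⟧-∂y (suc zero) zero [] = refl
⟦-yY⟧-∂y (suc zero) zero (c ∷ w) = refl
⟦-yY⟧-∂y (suc zero) (suc j) w = refl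
⟦-yY⟧-∂y (suc (suc i)) j w = refl

⟦zZ⟧-ε : ∀ i j → ⟦ zZ ⟧ i j [] ≡ 0ℚ
⟦zZ⟧-ε zero zero = refl
⟦zZ⟧-ε zero (suc zero) = refl
⟦zZ⟧-ε zero (suc (suc j)) = refl
⟦zZ⟧-ε (suc i) j = refl

⟦zZ⟧-∂ : ∀ c → ∂ˢ c ⟦ zZ ⟧ ≋ mulZ ⟦ sone ⟧
⟦zZ⟧-∂ c zero zero w = refl
⟦zZ⟧-∂ x zero (suc zero) [] = refl
⟦zZ⟧-∂ x zero (suc zero) (c ∷ w) = refl
⟦zZ⟧-∂ y zero (suc zero) [] = refl
⟦zZ⟧-∂ y zero (suc zero) (c ∷ w) = refl
⟦zZ⟧-∂ c zero (suc (suc j)) w = refl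
⟦zZ⟧-∂ c (suc i) zero w = refl
⟦zZ⟧-∂ c (suc i) (suc j) w = refl

geomY : CoeffSeries
geomY = ⟦ geom (sneg yY) ⟧

geomZ : CoeffSeries
geomZ = ⟦ geom zZ ⟧

module GeomY = GeometricSeries (sneg yY) ⟦-yY⟧-ε
module GeomZ = GeometricSeries zZ ⟦zZ⟧-ε

geomY-ε : ∀ a b → geomY a b [] ≡ δ₀ a b
geomY-ε = GeomY.geom-ε

geomY-∂x : ∂ˢ x geomY ≋ 0ˢ
geomY-∂x = GeomY.geom-∂-zero x (λ m a b w →
  trans (GeomY.pow-∂ m x a b w) (⋆·-zeroˡ (∂ˢ x ⟦ sneg yY ⟧) ⟦ spow (sneg yY) m ⟧ ⟦-yY⟧-∂x a b w))

geomY-∂y : ∂ˢ y geomY ≋ -ˢ mulY geomY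
geomY-∂y = GeomY.geom-∂-mulY y pow-∂y
  where
  pow-∂y : ∀ m → ∂ˢ y ⟦ spow (sneg yY) (suc m) ⟧ ≋ -ˢ mulY ⟦ spow (sneg yY) m ⟧
  pow-∂y m a b w = begin
    ∂ˢ y ⟦ spow (sneg yY) (suc m) ⟧ a b w     ≡⟨ GeomY.pow-∂ m y a b w ⟩
    (∂ˢ y ⟦ sneg yY ⟧ ⋆· P) a b w             ≡⟨ ⋆·-congˡ P ⟦-yY⟧-∂y a b w ⟩
    ((-ˢ mulY ⟦ sone ⟧) ⋆· P) a b w           ≡⟨ ⋆·-negˡ (mulY ⟦ sone ⟧) P a b w ⟩
    - (mulY ⟦ sone ⟧ ⋆· P) a b w              ≡⟨ cong -_ (⋆·-mulYˡ ⟦ sone ⟧ P a b w) ⟩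
    - mulY (⟦ sone ⟧ ⋆· P) a b w              ≡⟨ cong -_ (mulY-cong (λ a′ b′ → ⋆·-sone P a′ b′ w) a b) ⟩
    - mulY P a b w                            ∎
    where
    open ≡-Reasoning
    P = ⟦ spow (sneg yY) m ⟧

geomY-Z-free : ∀ a b → geomY a (suc b) ≗ 0ᶠ
geomY-Z-free zero b [] = geomY-ε 0 (suc b)
geomY-Z-free (suc a) b [] = geomY-ε (suc a) (suc b)
geomY-Z-free a b (x ∷ w) = geomY-∂x a (suc b) w
geomY-Z-free zero b (y ∷ w) = geomY-∂y 0 (suc b) w
geomY-Z-free (suc a) b (y ∷ w) = trans (geomY-∂y (suc a) (suc b) w) (cong -_ (geomY-Z-free a b w))

geomZ-ε : ∀ a b → geomZ a b [] ≡ δ₀ a b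
geomZ-ε = GeomZ.geom-ε

geomZ-∂ : ∀ c → ∂ˢ c geomZ ≋ mulZ geomZ
geomZ-∂ c = GeomZ.geom-∂-mulZ c pow-∂
  where
  pow-∂ : ∀ m → ∂ˢ c ⟦ spow zZ (suc m) ⟧ ≋ mulZ ⟦ spow zZ m ⟧
  pow-∂ m a b w = begin
    ∂ˢ c ⟦ spow zZ (suc m) ⟧ a b w            ≡⟨ GeomZ.pow-∂ m c a b w ⟩
    (∂ˢ c ⟦ zZ ⟧ ⋆· P) a b w                  ≡⟨ ⋆·-congˡ P (⟦zZ⟧-∂ c) a b w ⟩
    (mulZ ⟦ sone ⟧ ⋆· P) a b w                ≡⟨ ⋆·-mulZˡ ⟦ sone ⟧ P a b w ⟩
    mulZ (⟦ sone ⟧ ⋆· P) a b w                ≡⟨ mulZ-cong (λ a′ b′ → ⋆·-sone P a′ b′ w) a b ⟩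
    mulZ P a b w                              ∎
    where
    open ≡-Reasoning
    P = ⟦ spow zZ m ⟧

geomZ⋆шgeomY-solves : Solves (geomZ ⋆ш geomY)
geomZ⋆шgeomY-solves = record
  { ε-coeff = antidiagonal²-δ₀-δ₀ geomZ-ε geomY-ε
  ; ∂x-eq = λ a b w → begin
      ∂ˢ x R a b w                                   ≡⟨ ⋆ш-∂ geomZ geomY x a b w ⟩
      (∂ˢ x geomZ ⋆ш geomY) a b w + (geomZ ⋆ш ∂ˢ x geomY) a b w
        ≡⟨ cong₂ _+_ (∂geomZ⋆шgeomY x a b w) (⋆ш-zeroʳ geomZ (∂ˢ x geomY) geomY-∂x a b w) ⟩
      mulZ R a b w + 0ℚ                              ≡⟨ +-identityʳ _ ⟩
      mulZ R a b w                                   ∎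
  ; ∂y-eq = λ a b w → begin
      ∂ˢ y R a b w                                   ≡⟨ ⋆ш-∂ geomZ geomY y a b w ⟩
      (∂ˢ y geomZ ⋆ш geomY) a b w + (geomZ ⋆ш ∂ˢ y geomY) a b w
        ≡⟨ cong₂ _+_ (∂geomZ⋆шgeomY y a b w) (⋆ш-congʳ geomZ geomY-∂y a b w) ⟩
      mulZ R a b w + (geomZ ⋆ш (-ˢ mulY geomY)) a b w
        ≡⟨ cong (mulZ R a b w +_) (trans (⋆ш-negʳ geomZ (mulY geomY) a b w) (cong -_ (⋆ш-mulYʳ geomZ geomY a b w))) ⟩
      mulZ R a b w - mulY R a b w                    ∎
  }
  where
  open ≡-Reasoning
  R = geomZ ⋆ш geomY
  ∂geomZ⋆шgeomY : ∀ c → ∂ˢ c geomZ ⋆ш geomY ≋ mulZ R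
  ∂geomZ⋆шgeomY c a b w =
    trans (⋆ш-congˡ geomY (geomZ-∂ c) a b w) (⋆ш-mulZˡ geomZ geomY a b w)

⟦phiP⟧-∷ : ∀ c v p → ⟦ phiP ((c , v) ∷ p) ⟧ ≋ c *ˢ ⟦ phiW v ⟧ +ˢ ⟦ phiP p ⟧
⟦phiP⟧-∷ c v p k l w =
  trans (coeff-++ (pscale c (phiW v k l)) (phiP p k l) w) (cong (_+ ⟦ phiP p ⟧ k l w) (coeff-pscale c (phiW v k l) w))

⟦phiP⟧-++ : ∀ p q → ⟦ phiP (p ++ q) ⟧ ≋ ⟦ phiP p ⟧ +ˢ ⟦ phiP q ⟧
⟦phiP⟧-++ [] q k l w = sym (+-identityˡ _)
⟦phiP⟧-++ ((c , v) ∷ p) q k l w = begin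
  ⟦ phiP ((c , v) ∷ p ++ q) ⟧ k l w       ≡⟨ ⟦phiP⟧-∷ c v (p ++ q) k l w ⟩
  C + ⟦ phiP (p ++ q) ⟧ k l w             ≡⟨ cong (C +_) (⟦phiP⟧-++ p q k l w) ⟩
  C + (⟦ phiP p ⟧ k l w + ⟦ phiP q ⟧ k l w) ≡˘⟨ +-assoc C _ _ ⟩
  C + ⟦ phiP p ⟧ k l w + ⟦ phiP q ⟧ k l w ≡˘⟨ cong (_+ ⟦ phiP q ⟧ k l w) (⟦phiP⟧-∷ c v p k l w) ⟩
  ⟦ phiP ((c , v) ∷ p) ⟧ k l w + ⟦ phiP q ⟧ k l w ∎
  where
  open ≡-Reasoning
  C = c * ⟦ phiW v ⟧ k l w

⟦phiP⟧-isAdditive : ∀ k l w → IsAdditive (λ p → ⟦ phiP p ⟧ k l w)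
⟦phiP⟧-isAdditive k l w = record { []-zero = refl ; ++-homo = λ p q → ⟦phiP⟧-++ p q k l w }

pmul-∷ : ∀ t p q → pmul (t ∷ p) q ≡ pmul (t ∷ []) q ++ pmul p q
pmul-∷ (c , v) p q = cong (_++ pmul p q) (sym (++-identityʳ _))

⟦phiP⟧-letter· : ∀ c u q → ⟦ phiP (pmul ((c , u ∷ []) ∷ []) q) ⟧ ≋ c *ˢ (⟦ phiL u ⟧ ⋆· ⟦ phiP q ⟧)
⟦phiP⟧-letter· c u [] k l w = sym (trans (cong (c *_) (⋆·-zeroʳ ⟦ phiL u ⟧ 0ˢ (λ _ _ _ → refl) k l w)) (*-zeroʳ c))
⟦phiP⟧-letter· c u ((d , v) ∷ q) k l w = begin
  ⟦ phiP ((c * d , u ∷ v) ∷ pmul ((c , u ∷ []) ∷ []) q) ⟧ k l w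
    ≡⟨ ⟦phiP⟧-∷ (c * d) (u ∷ v) (pmul ((c , u ∷ []) ∷ []) q) k l w ⟩
  c * d * ⟦ phiW (u ∷ v) ⟧ k l w + ⟦ phiP (pmul ((c , u ∷ []) ∷ []) q) ⟧ k l w
    ≡⟨ cong₂ _+_ (cong (c * d *_) (⟦smul⟧ (phiL u) (phiW v) k l w)) (⟦phiP⟧-letter· c u q k l w) ⟩
  c * d * (Φu ⋆· W) k l w + c * (Φu ⋆· Q) k l w
    ≡⟨ solve 4 (λ c d A B → c :* d :* A :+ c :* B := c :* (d :* A :+ B)) refl c d _ _ ⟩
  c * (d * (Φu ⋆· W) k l w + (Φu ⋆· Q) k l w)
    ≡˘⟨ cong (λ t → c * (t + (Φu ⋆· Q) k l w)) (⋆·-scaleʳ d Φu W k l w) ⟩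
  c * ((Φu ⋆· (d *ˢ W)) k l w + (Φu ⋆· Q) k l w)
    ≡˘⟨ cong (c *_) (⋆·-distribˡ Φu (d *ˢ W) Q k l w) ⟩
  c * (Φu ⋆· (d *ˢ W +ˢ Q)) k l w
    ≡˘⟨ cong (c *_) (⋆·-congʳ Φu (⟦phiP⟧-∷ d v q) k l w) ⟩
  c * (Φu ⋆· ⟦ phiP ((d , v) ∷ q) ⟧) k l w ∎
  where
  open ≡-Reasoning
  Φu = ⟦ phiL u ⟧
  W = ⟦ phiW v ⟧
  Q = ⟦ phiP q ⟧

Φz : CoeffSeries
Φz = ⟦ phiL x ⟧ +ˢ ⟦ phiL y ⟧

⟦phiP⟧-z· : ∀ q → ⟦ phiP (pmul zP q) ⟧ ≋ Φz ⋆· ⟦ phiP q ⟧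
⟦phiP⟧-z· q k l w = begin
  ⟦ phiP (pmul zP q) ⟧ k l w
    ≡⟨ cong (λ r → ⟦ phiP r ⟧ k l w) (pmul-∷ (1ℚ , x ∷ []) ((1ℚ , y ∷ []) ∷ []) q) ⟩
  ⟦ phiP (pmul ((1ℚ , x ∷ []) ∷ []) q ++ pmul ((1ℚ , y ∷ []) ∷ []) q) ⟧ k l w
    ≡⟨ ⟦phiP⟧-++ (pmul ((1ℚ , x ∷ []) ∷ []) q) (pmul ((1ℚ , y ∷ []) ∷ []) q) k l w ⟩
  ⟦ phiP (pmul ((1ℚ , x ∷ []) ∷ []) q) ⟧ k l w + ⟦ phiP (pmul ((1ℚ , y ∷ []) ∷ []) q) ⟧ k l w
    ≡⟨ cong₂ _+_ (⟦phiP⟧-letter· 1ℚ x q k l w) (⟦phiP⟧-letter· 1ℚ y q k l w) ⟩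
  1ℚ * (⟦ phiL x ⟧ ⋆· Q) k l w + 1ℚ * (⟦ phiL y ⟧ ⋆· Q) k l w
    ≡⟨ cong₂ _+_ (*-identityˡ ((⟦ phiL x ⟧ ⋆· Q) k l w)) (*-identityˡ ((⟦ phiL y ⟧ ⋆· Q) k l w)) ⟩
  (⟦ phiL x ⟧ ⋆· Q) k l w + (⟦ phiL y ⟧ ⋆· Q) k l w
    ≡˘⟨ ⋆·-distribʳ ⟦ phiL x ⟧ ⟦ phiL y ⟧ Q k l w ⟩
  (Φz ⋆· Q) k l w ∎
  where
  open ≡-Reasoning
  Q = ⟦ phiP q ⟧

⟦z⟧-ε : ∀ i j → ⟦ sconst zP ⟧ i j [] ≡ 0ℚ
⟦z⟧-ε zero zero = refl
⟦z⟧-ε zero (suc j) = refl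
⟦z⟧-ε (suc i) j = refl

⟦z⟧-∂ : ∀ c → ∂ˢ c ⟦ sconst zP ⟧ ≋ ⟦ sone ⟧
⟦z⟧-∂ x zero zero [] = refl
⟦z⟧-∂ x zero zero (c ∷ w) = refl
⟦z⟧-∂ y zero zero [] = refl
⟦z⟧-∂ y zero zero (c ∷ w) = refl
⟦z⟧-∂ c zero (suc j) w = refl
⟦z⟧-∂ c (suc i) j w = refl

Φz≋z⋆geomY : Φz ≋ ⟦ sconst zP ⟧ ⋆· geomY
Φz≋z⋆geomY i j v = begin
  X + coeff (smul (sconst zP) (geom (sneg yY)) i j ++ pscale (- 1ℚ) (sconst xP i j)) v
    ≡⟨ cong (X +_) (coeff-++ (smul (sconst zP) (geom (sneg yY)) i j) (pscale (- 1ℚ) (sconst xP i j)) v) ⟩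
  X + (⟦ smul (sconst zP) (geom (sneg yY)) ⟧ i j v + coeff (pscale (- 1ℚ) (sconst xP i j)) v)
    ≡⟨ cong (λ t → X + (t + coeff (pscale (- 1ℚ) (sconst xP i j)) v)) (⟦smul⟧ (sconst zP) (geom (sneg yY)) i j v) ⟩
  X + (A + coeff (pscale (- 1ℚ) (sconst xP i j)) v)
    ≡⟨ cong (λ t → X + (A + t)) (coeff-pscale (- 1ℚ) (sconst xP i j) v) ⟩
  X + (A + - 1ℚ * X)
    ≡⟨ solve 2 (λ X A → X :+ (A :+ con (- 1ℚ) :* X) := A) refl X A ⟩
  A ∎
  where
  open ≡-Reasoning
  X = ⟦ sconst xP ⟧ i j v
  A = (⟦ sconst zP ⟧ ⋆· geomY) i j v

Φz-ε : ∀ i j → Φz i j [] ≡ 0ℚ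
Φz-ε i j = trans (Φz≋z⋆geomY i j []) (⋆·-ε-zeroˡ ⟦ sconst zP ⟧ geomY ⟦z⟧-ε i j)

Φz-∂ : ∀ c → ∂ˢ c Φz ≋ geomY
Φz-∂ c i j v = begin
  Φz i j (c ∷ v)                            ≡⟨ Φz≋z⋆geomY i j (c ∷ v) ⟩
  ∂ˢ c (⟦ sconst zP ⟧ ⋆· geomY) i j v       ≡⟨ ⋆·-∂-zeroˡ ⟦ sconst zP ⟧ geomY ⟦z⟧-ε c i j v ⟩
  (∂ˢ c ⟦ sconst zP ⟧ ⋆· geomY) i j v       ≡⟨ ⋆·-congˡ geomY (⟦z⟧-∂ c) i j v ⟩
  (⟦ sone ⟧ ⋆· geomY) i j v                 ≡⟨ ⋆·-sone geomY i j v ⟩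
  geomY i j v                               ∎
  where open ≡-Reasoning

Φz-Z-free : ∀ i j → Φz i (suc j) ≗ 0ᶠ
Φz-Z-free i j [] = Φz-ε i (suc j)
Φz-Z-free i j (c ∷ v) = trans (Φz-∂ c i (suc j) v) (geomY-Z-free i j v)

Φz^ : ℕ → CoeffSeries
Φz^ zero = ⟦ sone ⟧
Φz^ (suc m) = Φz ⋆· Φz^ m

Φz^-Z-free : ∀ m k l → Φz^ m k (suc l) ≗ 0ᶠ
Φz^-Z-free zero zero l w = refl
Φz^-Z-free zero (suc k) l w = refl
Φz^-Z-free (suc m) k l w =
  trans (⋆·-Z-freeˡ Φz (Φz^ m) Φz-Z-free k (suc l) w)
        (antidiagonal-zero k (λ i k′ → ·-zeroʳ (Φz i 0) (Φz^-Z-free m k′ l) w))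

-- whether Y^i Z^j is Z^m, the only monomial of (zZ)^m
isZPower : ℕ → ℕ → ℕ → Bool
isZPower m zero j = m ≡ᵇ j
isZPower m (suc i) j = false

isZPower-suc : ∀ m i j → isZPower (suc m) i (suc j) ≡ isZPower m i j
isZPower-suc m zero j = refl
isZPower-suc m (suc i) j = refl

isZPower-Z⁰ : ∀ m i → isZPower (suc m) i 0 ≡ false
isZPower-Z⁰ m zero = refl
isZPower-Z⁰ m (suc i) = refl

sum<-≡ᵇ : ∀ j (X : ℕ → ℚ) → sum< (λ m → if m ≡ᵇ j then X m else 0ℚ) (suc j) ≡ X j
sum<-≡ᵇ zero X = +-identityʳ (X 0)
sum<-≡ᵇ (suc j) X = trans (+-identityˡ _) (sum<-≡ᵇ j (λ m → X (suc m)))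

⋆·-if : ∀ (t : Bool) F H →
  F ⋆· (λ k l w → if t then H k l w else 0ℚ) ≋ (λ a b w → if t then (F ⋆· H) a b w else 0ℚ)
⋆·-if true F H a b w = refl
⋆·-if false F H a b w = ⋆·-zeroʳ F (λ _ _ _ → 0ℚ) (λ _ _ _ → refl) a b w

⟦phiP-zZ^⟧ : ∀ m i j → ⟦ phiP (spow zZ m i j) ⟧ ≋ (λ k l w → if isZPower m i j then Φz^ m k l w else 0ℚ)
⟦phiP-zZ^⟧ zero zero zero k l w = trans (⟦phiP⟧-∷ 1ℚ [] [] k l w) (trans (+-identityʳ _) (*-identityˡ _))
⟦phiP-zZ^⟧ zero zero (suc j) k l w = refl
⟦phiP-zZ^⟧ zero (suc i) j k l w = refl
⟦phiP-zZ^⟧ (suc m) i j k l w =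
  trans (IsAdditive.concatMap-antidiagonal² (⟦phiP⟧-isAdditive k l w)
                                             (λ i′ j′ i″ j″ → pmul (zZ i′ j′) (spow zZ m i″ j″)) i j)
        (trans (antidiagonal-first i (λ i′ i″ → antidiagonal-zero j (λ j′ j″ → refl))) (along-Z j))
  where
  f : ℕ → ℕ → ℚ
  f j′ j″ = ⟦ phiP (pmul (zZ 0 j′) (spow zZ m i j″)) ⟧ k l w
  along-Z : ∀ j → antidiagonal f j ≡ (if isZPower (suc m) i j then Φz^ (suc m) k l w else 0ℚ)
  along-Z zero = cong (λ t → if t then Φz^ (suc m) k l w else 0ℚ) (sym (isZPower-Z⁰ m i))
  along-Z (suc j) = begin
    antidiagonal f (suc j)                       ≡⟨ antidiagonal-shiftˡ {f} j (λ _ → refl) ⟩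
    antidiagonal (λ j′ j″ → f (suc j′) j″) j     ≡⟨ antidiagonal-first j (λ _ _ → refl) ⟩
    ⟦ phiP (pmul zP (spow zZ m i j)) ⟧ k l w     ≡⟨ ⟦phiP⟧-z· (spow zZ m i j) k l w ⟩
    (Φz ⋆· ⟦ phiP (spow zZ m i j) ⟧) k l w       ≡⟨ ⋆·-congʳ Φz (⟦phiP-zZ^⟧ m i j) k l w ⟩
    (Φz ⋆· (λ k′ l′ w′ → if isZPower m i j then Φz^ m k′ l′ w′ else 0ℚ)) k l w
      ≡⟨ ⋆·-if (isZPower m i j) Φz (Φz^ m) k l w ⟩
    (if isZPower m i j then Φz^ (suc m) k l w else 0ℚ)
      ≡˘⟨ cong (λ t → if t then Φz^ (suc m) k l w else 0ℚ) (isZPower-suc m i j) ⟩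
    (if isZPower (suc m) i (suc j) then Φz^ (suc m) k l w else 0ℚ) ∎
    where open ≡-Reasoning

-- Φ(1/(1 − zZ)) = Σ_m Φ(z)^m Z^m, where Φ(z)^m does not involve Z.
ΦgeomZ : CoeffSeries
ΦgeomZ a b = Φz^ b a 0

⟦Φ-geomZ⟧ : ⟦ Φ (geom zZ) ⟧ ≋ ΦgeomZ
⟦Φ-geomZ⟧ a b w = begin
  ⟦ Φ (geom zZ) ⟧ a b w
    ≡⟨ IsAdditive.concatMap-antidiagonal² (coeff-isAdditive w) (λ i j k l → phiP (geom zZ i j) k l) a b ⟩
  antidiagonal² (λ i j k l → ⟦ phiP (geom zZ i j) ⟧ k l w) a b
    ≡⟨ antidiagonal²-cong a b (λ i j k l → geom-terms i j k l) ⟩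
  antidiagonal² (λ i j k l → sum< (λ m → if isZPower m i j then Φz^ m k l w else 0ℚ) (suc (i +ℕ j))) a b
    ≡⟨ antidiagonal-first a (λ i k → antidiagonal-zero b (λ j l → sum<-zero (suc (suc i +ℕ j)) (λ _ → refl))) ⟩
  antidiagonal (λ j l → sum< (λ m → if m ≡ᵇ j then Φz^ m a l w else 0ℚ) (suc j)) b
    ≡⟨ antidiagonal-cong b (λ j l → sum<-≡ᵇ j (λ m → Φz^ m a l w)) ⟩
  antidiagonal (λ j l → Φz^ j a l w) b
    ≡⟨ antidiagonal-last b (λ j l → Φz^-Z-free j a l w) ⟩
  Φz^ b a 0 w ∎
  where
  open ≡-Reasoning
  geom-terms : ∀ i j k l →
    ⟦ phiP (geom zZ i j) ⟧ k l w ≡ sum< (λ m → if isZPower m i j then Φz^ m k l w else 0ℚ) (suc (i +ℕ j))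
  geom-terms i j k l =
    trans (IsAdditive.concatMap-applyUpTo (⟦phiP⟧-isAdditive k l w) (λ m → spow zZ m i j) (λ m → m) (suc (i +ℕ j)))
          (sum<-cong (suc (i +ℕ j)) (λ m → ⟦phiP-zZ^⟧ m i j k l w))

ΦgeomZ-ε : ∀ a b → ΦgeomZ a b [] ≡ δ₀ a b
ΦgeomZ-ε a zero = ⟦sone⟧-ε a 0
ΦgeomZ-ε zero (suc b) = ⋆·-ε-zeroˡ Φz (Φz^ b) Φz-ε 0 0
ΦgeomZ-ε (suc a) (suc b) = ⋆·-ε-zeroˡ Φz (Φz^ b) Φz-ε (suc a) 0

ΦgeomZ-∂ : ∀ c → ∂ˢ c ΦgeomZ ≋ mulZ (geomY ⋆· ΦgeomZ)
ΦgeomZ-∂ c a zero w = ⟦sone⟧-∂ c a 0 w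
ΦgeomZ-∂ c a (suc b) w = begin
  ∂ˢ c (Φz ⋆· Φz^ b) a 0 w                            ≡⟨ ⋆·-∂-zeroˡ Φz (Φz^ b) Φz-ε c a 0 w ⟩
  (∂ˢ c Φz ⋆· Φz^ b) a 0 w                            ≡⟨ ⋆·-congˡ (Φz^ b) (Φz-∂ c) a 0 w ⟩
  (geomY ⋆· Φz^ b) a 0 w                              ≡⟨ ⋆·-Z-freeˡ geomY (Φz^ b) geomY-Z-free a 0 w ⟩
  antidiagonal (λ i k → (geomY i 0 · Φz^ b k 0) w) a  ≡˘⟨ ⋆·-Z-freeˡ geomY ΦgeomZ geomY-Z-free a b w ⟩
  (geomY ⋆· ΦgeomZ) a b w                             ∎
  where open ≡-Reasoning

geomY⋆·ΦgeomZ-solves : Solves (geomY ⋆· ΦgeomZ)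
geomY⋆·ΦgeomZ-solves = record
  { ε-coeff = antidiagonal²-δ₀-δ₀ geomY-ε ΦgeomZ-ε
  ; ∂x-eq = λ a b w → begin
      ∂ˢ x L a b w                                     ≡⟨ ⋆·-∂-unitˡ geomY ΦgeomZ geomY-ε x a b w ⟩
      ∂ˢ x ΦgeomZ a b w + (∂ˢ x geomY ⋆· ΦgeomZ) a b w
        ≡⟨ cong₂ _+_ (ΦgeomZ-∂ x a b w) (⋆·-zeroˡ (∂ˢ x geomY) ΦgeomZ geomY-∂x a b w) ⟩
      mulZ L a b w + 0ℚ                                ≡⟨ +-identityʳ _ ⟩
      mulZ L a b w                                     ∎
  ; ∂y-eq = λ a b w → begin
      ∂ˢ y L a b w                                     ≡⟨ ⋆·-∂-unitˡ geomY ΦgeomZ geomY-ε y a b w ⟩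
      ∂ˢ y ΦgeomZ a b w + (∂ˢ y geomY ⋆· ΦgeomZ) a b w
        ≡⟨ cong₂ _+_ (ΦgeomZ-∂ y a b w) (⋆·-congˡ ΦgeomZ geomY-∂y a b w) ⟩
      mulZ L a b w + ((-ˢ mulY geomY) ⋆· ΦgeomZ) a b w
        ≡⟨ cong (mulZ L a b w +_)
                (trans (⋆·-negˡ (mulY geomY) ΦgeomZ a b w) (cong -_ (⋆·-mulYˡ geomY ΦgeomZ a b w))) ⟩
      mulZ L a b w - mulY L a b w                      ∎
  }
  where
  open ≡-Reasoning
  L = geomY ⋆· ΦgeomZ

lemma1 : smul (geom (sneg yY)) (Φ (geom zZ)) ≈ₛ ssh (geom zZ) (geom (sneg yY))
lemma1 a b w = begin
  ⟦ smul (geom (sneg yY)) (Φ (geom zZ)) ⟧ a b w  ≡⟨ ⟦smul⟧ (geom (sneg yY)) (Φ (geom zZ)) a b w ⟩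
  (geomY ⋆· ⟦ Φ (geom zZ) ⟧) a b w              ≡⟨ ⋆·-congʳ geomY ⟦Φ-geomZ⟧ a b w ⟩
  (geomY ⋆· ΦgeomZ) a b w                        ≡⟨ Solves-unique geomY⋆·ΦgeomZ-solves geomZ⋆шgeomY-solves a b w ⟩
  (geomZ ⋆ш geomY) a b w                         ≡˘⟨ ⟦ssh⟧ (geom zZ) (geom (sneg yY)) a b w ⟩
  ⟦ ssh (geom zZ) (geom (sneg yY)) ⟧ a b w       ∎
  where open ≡-Reasoning
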